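{- Let $m \geq 2$ be an integer. Suppose an edge-coloring of the complete graph $K_n$ contains no rainbow triangle and no monochromatic copy of $B_m$, and suppose it has a Gallai-partition in which every part has at most $m-1$ vertices. Then $$ n \leq R_m' := \sum_{i=1}^{m-1} \left[ R\big(B_{\lceil m/i\rceil}, B_{\lceil m/i\rceil}\big) - 1 \right]. $$
   Context: $B_j = K_2 + \overline{K_j}$ is the book with $j$ pages: an edge $uv$ together with $j$ further vertices each adjacent to both $u$ and $v$ (so $B_1 = K_3$). $R(G,H)$ is the 2-color Ramsey number. A triangle is rainbow if its three edges have distinct colors. A Gallai-partition of an edge-colored complete graph is a partition of the vertex set into at least two parts such that, for each pair of distinct parts, all edges between them receive a single color, and in total at most two colors appear on edges between parts. (Every coloring of a complete graph with no rainbow triangle has such a partition.) -}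

module Defs where

open import Data.Nat using (ℕ; zero; suc; _+_; _∸_; _≤_; _<_)
open import Data.Nat.DivMod using (_/_)
open import Data.Fin using (Fin; _≟_)
open import Data.List using (List; length; filter; map; upTo; allFin)
open import Data.Nat.ListAction using (sum)
open import Data.Product using (Σ; ∃; ∃-syntax; _×_; _,_)
open import Data.Sum using (_⊎_)
open import Relation.Nullary using (¬_)
open import Relation.Binary.PropositionalEquality using (_≡_; _≢_)
open import Function.Definitions using (Injective; Surjective)

-- An edge-coloring of K_n with colors from C: a symmetric function on pairs of
-- vertices (its value on the diagonal x = x is irrelevant and never used).
Coloring : ℕ → Set → Set
Coloring n C = Fin n → Fin n → C

SymmetricColoring : {n : ℕ} {C : Set} → Coloring n C → Set
SymmetricColoring {n} c = (x y : Fin n) → c x y ≡ c y x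

HasRainbowTriangle : {n : ℕ} {C : Set} → Coloring n C → Set
HasRainbowTriangle {n} c =
  Σ (Fin n) λ x → Σ (Fin n) λ y → Σ (Fin n) λ z →
    x ≢ y × y ≢ z × x ≢ z ×
    c x y ≢ c y z × c y z ≢ c x z × c x y ≢ c x z

-- A monochromatic copy of the book B_j = K_2 + \bar{K_j}: a spine uv and j
-- distinct further vertices w_1..w_j, each adjacent to u and v, all 2j+1 edges
-- having the same color.
HasMonoBook : {n : ℕ} {C : Set} → ℕ → Coloring n C → Set
HasMonoBook {n} {C} j c =
  Σ C λ col → Σ (Fin n) λ u → Σ (Fin n) λ v → Σ (Fin j → Fin n) λ w →
    u ≢ v × Injective _≡_ _≡_ w ×
    ((i : Fin j) → w i ≢ u × w i ≢ v) ×
    c u v ≡ col ×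
    ((i : Fin j) → c u (w i) ≡ col × c v (w i) ≡ col)

Arrows : ℕ → ℕ → Set
Arrows N j = (c : Coloring N (Fin 2)) → SymmetricColoring c → HasMonoBook j c

IsRamseyBook : ℕ → ℕ → Set
IsRamseyBook j N = Arrows N j × ((N' : ℕ) → N' < N → ¬ Arrows N' j)

partSize : {n t : ℕ} → (Fin n → Fin t) → Fin t → ℕ
partSize {n} p i = length (filter (λ x → p x ≟ i) (allFin n))

IsGallaiPartition : {n : ℕ} {C : Set} → Coloring n C → (t : ℕ) → (Fin n → Fin t) → Set
IsGallaiPartition {n} {C} c t p =
  2 ≤ t × Surjective _≡_ _≡_ p ×
  ((x y x' y' : Fin n) → p x ≡ p x' → p y ≡ p y' → p x ≢ p y → c x y ≡ c x' y') ×
  (Σ C λ a → Σ C λ b → (x y : Fin n) → p x ≢ p y → c x y ≡ a ⊎ c x y ≡ b)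

-- ⌈ m / i ⌉ for i ≥ 1, written for i = suc k.
ceilDivSuc : ℕ → ℕ → ℕ
ceilDivSuc m k = (m + k) / suc k

-- R'_m = Σ_{i=1}^{m-1} [ R(B_⌈m/i⌉, B_⌈m/i⌉) - 1 ], given the Ramsey function R.
-- upTo (m ∸ 1) = [0, …, m-2], and i = suc k.
Rprime : (ℕ → ℕ) → ℕ → ℕ
Rprime R m = sum (map (λ k → R (ceilDivSuc m k) ∸ 1) (upTo (m ∸ 1)))

module Submission where

-- Fix a Gallai-partition of c whose parts have at most m - 1
-- vertices, and for k < m - 1 let  large k  be the list of parts with more
-- than k vertices.
--  * Counting: a vertex x of rank r inside its part (0 ≤ r < |part|) is
--    determined by r together with the position of its part in  large r,
--    hence  n ≤ Σ_{k < m-1} |large k|.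
--  * Each term: the parts in  large k  carry a reduced 2-coloring (the color
--    between two parts).  A monochromatic B_j there, j = ⌈m/(k+1)⌉, blows up
--    to a monochromatic B_m in c: the spine joins representatives of the two
--    spine parts and every page part supplies k + 1 ≥ m/j pages.  As c has no
--    monochromatic B_m, |large k| < R(B_j, B_j).
-- No rainbow triangles is needed only for the partition, which is assumed.

open import Defs
open import Data.Nat using (ℕ; _≤_; _∸_)
open import Data.Fin using (Fin)
open import Data.Product using (Σ; _×_)
open import Relation.Nullary using (¬_)

open import Data.Nat using (zero; suc; _+_; _*_; _<_; z≤n; _≤?_; _<?_) renaming (_≟_ to _≟ℕ_)
open import Data.Nat.Properties
  using (≤-refl; ≤-pred; +-mono-≤; <-≤-trans; ≮⇒≥; <⇒≤pred; +-comm; +-cancelˡ-≤; module ≤-Reasoning)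
open import Data.Nat.DivMod using (_%_; m≡m%n+[m/n]*n; m%n<n)
open import Data.Fin using (zero; suc; toℕ; _↑ˡ_; _↑ʳ_; inject≤; fromℕ<; remQuot; combine; splitAt; _≟_)
open import Data.Fin.Properties
  using (toℕ-injective; toℕ<n; toℕ-fromℕ<; inject≤-injective; injective⇒≤; combine-remQuot;
         ↑ˡ-injective; ↑ʳ-injective; splitAt-↑ˡ; splitAt-↑ʳ)
open import Data.List using (List; length; filter; map; applyUpTo; allFin; lookup)
open import Data.Nat.ListAction using (sum)
open import Data.List.Relation.Unary.All as All using (All)
open import Data.List.Relation.Unary.All.Properties using (all-filter)
open import Data.List.Relation.Unary.Any using (index)
open import Data.List.Relation.Unary.Any.Properties using (lookup-index)
open import Data.List.Relation.Unary.AllPairs using (_∷_)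
open import Data.List.Membership.Propositional using (_∈_)
open import Data.List.Membership.Propositional.Properties using (∈-lookup; ∈-filter⁺; ∈-allFin)
open import Data.List.Relation.Unary.Unique.Propositional using (Unique)
open import Data.List.Relation.Unary.Unique.Propositional.Properties using (allFin⁺; filter⁺)
open import Data.Product using (_,_; proj₁; proj₂; uncurry)
open import Data.Sum using (_⊎_; inj₁; inj₂)
open import Data.Empty using (⊥-elim)
open import Relation.Nullary using (yes; no)
open import Relation.Binary.PropositionalEquality
  using (_≡_; _≢_; refl; sym; trans; cong; cong₂; subst; module ≡-Reasoning)
open import Function using (_∘_)
open import Function.Definitions using (Injective; Surjective)

lookup-All : {A : Set} {P : A → Set} {xs : List A} →
  All P xs → (i : Fin (length xs)) → P (lookup xs i)
lookup-All pxs i = All.lookup pxs (∈-lookup i)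

lookup-injective : {A : Set} {xs : List A} → Unique xs →
  (i j : Fin (length xs)) → lookup xs i ≡ lookup xs j → i ≡ j
lookup-injective (_ ∷ _) zero zero _ = refl
lookup-injective (x∉ ∷ _) zero (suc j) e = ⊥-elim (lookup-All x∉ j e)
lookup-injective (x∉ ∷ _) (suc i) zero e = ⊥-elim (lookup-All x∉ i (sym e))
lookup-injective (_ ∷ u) (suc i) (suc j) e = cong suc (lookup-injective u i j e)

-- The two lists are only
-- required to be propositionally equal (and positions are compared as
-- numbers), since in use they are given by different expressions.
index-injective : {A : Set} {xs ys : List A} {a b : A} → xs ≡ ys →
  (a∈ : a ∈ xs) (b∈ : b ∈ ys) → toℕ (index a∈) ≡ toℕ (index b∈) → a ≡ b
index-injective {xs = xs} {a = a} {b} refl a∈ b∈ same = begin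
  a                    ≡⟨ lookup-index a∈ ⟩
  lookup xs (index a∈) ≡⟨ cong (lookup xs) (toℕ-injective same) ⟩
  lookup xs (index b∈) ≡⟨ lookup-index b∈ ⟨
  b                    ∎
  where open ≡-Reasoning

∑ : (K : ℕ) → (Fin K → ℕ) → ℕ
∑ zero    f = 0
∑ (suc K) f = f zero + ∑ K (f ∘ suc)

∑-mono : (K : ℕ) (f g : Fin K → ℕ) → (∀ k → f k ≤ g k) → ∑ K f ≤ ∑ K g
∑-mono zero    f g f≤g = z≤n
∑-mono (suc K) f g f≤g = +-mono-≤ (f≤g zero) (∑-mono K (f ∘ suc) (g ∘ suc) (f≤g ∘ suc))

sum-applyUpTo : (g h : ℕ → ℕ) (K : ℕ) →
  sum (map h (applyUpTo g K)) ≡ ∑ K (λ k → h (g (toℕ k)))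
sum-applyUpTo g h zero    = refl
sum-applyUpTo g h (suc K) = cong (h (g 0) +_) (sum-applyUpTo (g ∘ suc) h K)

inBlock : (K : ℕ) (f : Fin K → ℕ) (k : Fin K) → Fin (f k) → Fin (∑ K f)
inBlock (suc K) f zero    j = j ↑ˡ ∑ K (f ∘ suc)
inBlock (suc K) f (suc k) j = f zero ↑ʳ inBlock K (f ∘ suc) k j

↑ˡ≢↑ʳ : {a b : ℕ} (i : Fin a) (j : Fin b) → i ↑ˡ b ≢ a ↑ʳ j
↑ˡ≢↑ʳ {a} {b} i j e with trans (sym (splitAt-↑ˡ a i b)) (trans (cong (splitAt a) e) (splitAt-↑ʳ a b j))
... | ()

inBlock-injective : (K : ℕ) (f : Fin K → ℕ) (k k' : Fin K) (j : Fin (f k)) (j' : Fin (f k')) →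
  inBlock K f k j ≡ inBlock K f k' j' → k ≡ k' × toℕ j ≡ toℕ j'
inBlock-injective (suc K) f zero zero j j' e = refl , cong toℕ (↑ˡ-injective _ j j' e)
inBlock-injective (suc K) f zero (suc k') j j' e = ⊥-elim (↑ˡ≢↑ʳ j _ e)
inBlock-injective (suc K) f (suc k) zero j j' e = ⊥-elim (↑ˡ≢↑ʳ j' _ (sym e))
inBlock-injective (suc K) f (suc k) (suc k') j j' e
  with inBlock-injective K (f ∘ suc) k k' j j' (↑ʳ-injective (f zero) _ _ e)
... | same-block , same-position = cong suc same-block , same-position

fibrewise-bound : {n K : ℕ} (s : Fin K → ℕ) (level : Fin n → Fin K)
  (pos : (x : Fin n) → Fin (s (level x))) →
  (∀ {x y} → level x ≡ level y → toℕ (pos x) ≡ toℕ (pos y) → x ≡ y) →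
  n ≤ ∑ K s
fibrewise-bound {K = K} s level pos determined =
  injective⇒≤ (λ e → uncurry determined (inBlock-injective K s _ _ (pos _) (pos _) e))

-- Arrowing is monotone in the number of vertices: restrict a coloring of the
-- larger complete graph to its first M vertices.
arrows-mono : {M M' j : ℕ} → M ≤ M' → Arrows M j → Arrows M' j
arrows-mono {M} {M'} M≤M' arrows c' c'-sym
  with arrows (λ a b → c' (ι a) (ι b)) (λ a b → c'-sym (ι a) (ι b))
  where ι : Fin M → Fin M'
        ι a = inject≤ a M≤M'
... | col , u , v , w , u≢v , w-inj , w-off , c-spine , c-pages =
  col , ι u , ι v , ι ∘ w , u≢v ∘ ι-inj , w-inj ∘ ι-inj ,
  (λ i → proj₁ (w-off i) ∘ ι-inj , proj₂ (w-off i) ∘ ι-inj) , c-spine , c-pages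
  where ι : Fin M → Fin M'
        ι a = inject≤ a M≤M'
        ι-inj : {a b : Fin M} → ι a ≡ ι b → a ≡ b
        ι-inj = inject≤-injective M≤M' M≤M' _ _

below-Ramsey : {j N s : ℕ} → IsRamseyBook j N → ¬ Arrows s j → s ≤ N ∸ 1
below-Ramsey {N = N} {s} (arrows-N , _) ¬arrows with s <? N
... | yes s<N = <⇒≤pred s<N
... | no  s≮N = ⊥-elim (¬arrows (arrows-mono (≮⇒≥ s≮N) arrows-N))

-- ⌈m/i⌉ · i ≥ m  (for i = k + 1), since (m + k) % i ≤ k.
≤ceilDivSuc* : (m k : ℕ) → m ≤ ceilDivSuc m k * suc k
≤ceilDivSuc* m k = +-cancelˡ-≤ k m _ (begin
  k + m                                    ≡⟨ +-comm k m ⟩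
  m + k                                    ≡⟨ m≡m%n+[m/n]*n (m + k) (suc k) ⟩
  (m + k) % suc k + ceilDivSuc m k * suc k ≤⟨ +-mono-≤ (≤-pred (m%n<n (m + k) (suc k))) ≤-refl ⟩
  k + ceilDivSuc m k * suc k               ∎)
  where open ≤-Reasoning

splitInto : {m : ℕ} (j i : ℕ) → m ≤ j * i → Fin m → Fin j × Fin i
splitInto j i m≤ji a = remQuot i (inject≤ a m≤ji)

splitInto-injective : {m : ℕ} (j i : ℕ) (m≤ji : m ≤ j * i) → Injective _≡_ _≡_ (splitInto j i m≤ji)
splitInto-injective j i m≤ji {a} {a'} e = inject≤-injective m≤ji m≤ji a a' (begin
  inject≤ a m≤ji                             ≡⟨ combine-remQuot {j} i _ ⟨
  uncurry combine (splitInto j i m≤ji a)  ≡⟨ cong (uncurry combine) e ⟩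
  uncurry combine (splitInto j i m≤ji a') ≡⟨ combine-remQuot {j} i _ ⟩
  inject≤ a' m≤ji                            ∎)
  where open ≡-Reasoning

module GallaiPartition
  {n t : ℕ} (c : Coloring n ℕ) (c-sym : SymmetricColoring c)
  (p : Fin n → Fin t) (p-surj : Surjective _≡_ _≡_ p)
  (uniform : (x y x' y' : Fin n) → p x ≡ p x' → p y ≡ p y' → p x ≢ p y → c x y ≡ c x' y')
  (A B : ℕ) (two-colors : (x y : Fin n) → p x ≢ p y → c x y ≡ A ⊎ c x y ≡ B)
  where

  members : Fin t → List (Fin n)
  members P = filter (λ x → p x ≟ P) (allFin n)

  members-unique : (P : Fin t) → Unique (members P)
  members-unique P = filter⁺ (λ x → p x ≟ P) (allFin⁺ n)

  ∈-members : (x : Fin n) → x ∈ members (p x)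
  ∈-members x = ∈-filter⁺ (λ y → p y ≟ p x) (∈-allFin x) refl

  rep : Fin t → Fin n
  rep P = proj₁ (p-surj P)

  rep-in-part : {P : Fin t} → p (rep P) ≡ P
  rep-in-part {P} = proj₂ (p-surj P) refl

  toColor : ℕ → Fin 2
  toColor z with z ≟ℕ A
  ... | yes _ = zero
  ... | no  _ = suc zero

  fromColor : Fin 2 → ℕ
  fromColor zero    = A
  fromColor (suc _) = B

  fromColor-toColor : (z : ℕ) → z ≡ A ⊎ z ≡ B → fromColor (toColor z) ≡ z
  fromColor-toColor z z∈AB with z ≟ℕ A | z∈AB
  ... | yes z≡A | _       = sym z≡A
  ... | no  z≢A | inj₁ z≡A = ⊥-elim (z≢A z≡A)
  ... | no  _   | inj₂ z≡B = sym z≡B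

  reduced : {s : ℕ} → (Fin s → Fin t) → Coloring s (Fin 2)
  reduced Q a b = toColor (c (rep (Q a)) (rep (Q b)))

  reduced-symmetric : {s : ℕ} (Q : Fin s → Fin t) → SymmetricColoring (reduced Q)
  reduced-symmetric Q a b = cong toColor (c-sym _ _)

  between-parts : {s : ℕ} (Q : Fin s → Fin t) {a b : Fin s} {x y : Fin n} →
    p x ≡ Q a → p y ≡ Q b → Q a ≢ Q b → c x y ≡ fromColor (reduced Q a b)
  between-parts Q {a} {b} {x} {y} x∈a y∈b a≢b = begin
    c x y                       ≡⟨ uniform x y (rep (Q a)) (rep (Q b))
                                     (trans x∈a (sym rep-in-part)) (trans y∈b (sym rep-in-part))
                                     (λ e → a≢b (trans (sym x∈a) (trans e y∈b))) ⟩
    c (rep (Q a)) (rep (Q b))   ≡⟨ fromColor-toColor _ (two-colors _ _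
                                     (λ e → a≢b (trans (sym rep-in-part) (trans e rep-in-part)))) ⟨
    fromColor (reduced Q a b)   ∎
    where open ≡-Reasoning

  pick : {i : ℕ} (P : Fin t) → i ≤ partSize p P → Fin i → Fin n
  pick P big r = lookup (members P) (inject≤ r big)

  pick-in-part : {i : ℕ} {P : Fin t} (big : i ≤ partSize p P) (r : Fin i) → p (pick P big r) ≡ P
  pick-in-part {P = P} big r = lookup-All (all-filter (λ x → p x ≟ P) (allFin n)) (inject≤ r big)

  pick-injective : {i : ℕ} {P P' : Fin t} (big : i ≤ partSize p P) (big' : i ≤ partSize p P')
    {r r' : Fin i} → pick P big r ≡ pick P' big' r' → P ≡ P' × r ≡ r'
  pick-injective big big' {r} {r'} e
    with trans (sym (pick-in-part big r)) (trans (cong p e) (pick-in-part big' r'))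
  ... | refl = refl , inject≤-injective big big' r r' (lookup-injective (members-unique _) _ _ e)

  -- The spine joins the representatives of the two spine
  -- parts; the pages are i vertices from each of the j page parts.
  blow-up : {s i j m : ℕ} (Q : Fin s → Fin t) → Injective _≡_ _≡_ Q →
    (big : ∀ a → i ≤ partSize p (Q a)) → m ≤ j * i →
    HasMonoBook j (reduced Q) → HasMonoBook m c
  blow-up {s} {i} {j} {m} Q Q-inj big m≤ji (col , U , V , W , U≢V , W-inj , W-off , cUV , cW) =
    fromColor col , u , v , w , u≢v , w-inj , w-off , c-spine , c-pages
    where
    same-part : {a b : Fin s} {x y : Fin n} → p x ≡ Q a → p y ≡ Q b → x ≡ y → a ≡ b
    same-part x∈a y∈b x≡y = Q-inj (trans (sym x∈a) (trans (cong p x≡y) y∈b))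

    page : Fin m → Fin j
    page = proj₁ ∘ splitInto j i m≤ji

    copy : Fin m → Fin i
    copy = proj₂ ∘ splitInto j i m≤ji

    u v : Fin n
    u = rep (Q U)
    v = rep (Q V)

    w : Fin m → Fin n
    w a = pick (Q (W (page a))) (big _) (copy a)

    w-in-part : ∀ a → p (w a) ≡ Q (W (page a))
    w-in-part a = pick-in-part (big _) (copy a)

    u≢v : u ≢ v
    u≢v = U≢V ∘ same-part rep-in-part rep-in-part

    w-inj : Injective _≡_ _≡_ w
    w-inj {a} {a'} e with pick-injective (big _) (big _) e
    ... | same-page-part , same-copy =
      splitInto-injective j i m≤ji (cong₂ _,_ (W-inj (Q-inj same-page-part)) same-copy)

    w-off : ∀ a → w a ≢ u × w a ≢ v
    w-off a = proj₁ (W-off (page a)) ∘ same-part (w-in-part a) rep-in-part ,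
              proj₂ (W-off (page a)) ∘ same-part (w-in-part a) rep-in-part

    c-spine : c u v ≡ fromColor col
    c-spine = trans (between-parts Q rep-in-part rep-in-part (U≢V ∘ Q-inj)) (cong fromColor cUV)

    c-pages : ∀ a → c u (w a) ≡ fromColor col × c v (w a) ≡ fromColor col
    c-pages a =
      trans (between-parts Q rep-in-part (w-in-part a) (λ e → proj₁ (W-off (page a)) (Q-inj (sym e))))
            (cong fromColor (proj₁ (cW (page a)))) ,
      trans (between-parts Q rep-in-part (w-in-part a) (λ e → proj₂ (W-off (page a)) (Q-inj (sym e))))
            (cong fromColor (proj₂ (cW (page a))))

  large : ℕ → List (Fin t)
  large k = filter (λ P → suc k ≤? partSize p P) (allFin t)

  ∈-large : {P : Fin t} (k : ℕ) → k < partSize p P → P ∈ large k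
  ∈-large {P} k k<size = ∈-filter⁺ (λ Q → suc k ≤? partSize p Q) (∈-allFin P) k<size

  -- Without a monochromatic B_m in c, fewer than R(B_⌈m/(k+1)⌉) parts have
  -- more than k vertices: otherwise their reduced coloring arrows that book,
  -- which blows up to a monochromatic B_m.
  few-large-parts : (m k N : ℕ) → IsRamseyBook (ceilDivSuc m k) N → ¬ HasMonoBook m c →
    length (large k) ≤ N ∸ 1
  few-large-parts m k N ramsey no-book = below-Ramsey ramsey λ arrows →
    no-book (blow-up Q (lookup-injective (filter⁺ large? (allFin⁺ t)) _ _)
                     (lookup-All (all-filter large? (allFin t)))
                     (≤ceilDivSuc* m k) (arrows (reduced Q) (reduced-symmetric Q)))
    where large? = λ P → suc k ≤? partSize p P
          Q = lookup (large k)

  -- A vertex x is determined by its rank inside its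
  -- part together with the position of its part in  large (rank x).
  count-by-rank : (K : ℕ) → (∀ P → partSize p P ≤ K) → n ≤ ∑ K (λ k → length (large (toℕ k)))
  count-by-rank K small = fibrewise-bound _ level pos determined
    where
    rank : (x : Fin n) → Fin (partSize p (p x))
    rank x = index (∈-members x)

    level : Fin n → Fin K
    level x = fromℕ< (<-≤-trans (toℕ<n (rank x)) (small (p x)))

    toℕ-level : ∀ x → toℕ (level x) ≡ toℕ (rank x)
    toℕ-level x = toℕ-fromℕ< _

    part∈large : ∀ x → p x ∈ large (toℕ (level x))
    part∈large x = ∈-large _ (subst (_< partSize p (p x)) (sym (toℕ-level x)) (toℕ<n (rank x)))

    pos : (x : Fin n) → Fin (length (large (toℕ (level x))))
    pos x = index (part∈large x)

    determined : ∀ {x y} → level x ≡ level y → toℕ (pos x) ≡ toℕ (pos y) → x ≡ y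
    determined {x} {y} same-level same-pos =
      index-injective (cong members same-part) (∈-members x) (∈-members y)
        (trans (sym (toℕ-level x)) (trans (cong toℕ same-level) (toℕ-level y)))
      where same-part : p x ≡ p y
            same-part = index-injective (cong (large ∘ toℕ) same-level)
                          (part∈large x) (part∈large y) same-pos

lemma4p1 : (m : ℕ) → 2 ≤ m →
    (R : ℕ → ℕ) → ((j : ℕ) → IsRamseyBook j (R j)) →
    (n : ℕ) (c : Coloring n ℕ) → SymmetricColoring c →
    ¬ HasRainbowTriangle c → ¬ HasMonoBook m c →
    (Σ ℕ λ t → Σ (Fin n → Fin t) λ p →
       IsGallaiPartition c t p × ((i : Fin t) → partSize p i ≤ m ∸ 1)) →
    n ≤ Rprime R m
lemma4p1 m _ R ramsey n c c-sym _ no-book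
  (t , p , (_ , p-surj , uniform , A , B , two-colors) , small) = begin
  n                                               ≤⟨ count-by-rank (m ∸ 1) small ⟩
  ∑ (m ∸ 1) (λ k → length (large (toℕ k)))        ≤⟨ ∑-mono (m ∸ 1) _ _ (λ k →
                                                       few-large-parts m (toℕ k) _ (ramsey _) no-book) ⟩
  ∑ (m ∸ 1) (λ k → R (ceilDivSuc m (toℕ k)) ∸ 1)  ≡⟨ sum-applyUpTo (λ k → k) (λ k → R (ceilDivSuc m k) ∸ 1) (m ∸ 1) ⟨
  Rprime R m                                      ∎
  where open GallaiPartition c c-sym p p-surj uniform A B two-colors
        open ≤-Reasoning
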